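{- Let $r\ge1$ and let $G$ be a finite simple $r$--regular bipartite graph with bipartition $(X,Y)$. Then $G$ is totally silver if and only if $X=U_0\cup U_1\cup\cdots\cup U_r$ and $Y=V_0\cup V_1\cup\cdots\cup V_r$, where the sets $U_0,\ldots,U_r,V_0,\ldots,V_r$ are pairwise disjoint, such that for any distinct $i,j\in\{0,1,\ldots,r\}$, the subgraph of $G$ induced on $U_i\cup V_j$ is $1$--regular.
   Context: A totally silver coloring of a graph $G$ is a map $c$ from $V(G)$ to a set of colors such that for every $v\in V(G)$, each color appears exactly once on the closed neighborhood $N[v]=\{v\}\cup N(v)$. A graph is totally silver if it admits a totally silver coloring. A graph is $1$--regular if every vertex has degree exactly $1$. -}

module Defs where

open import Data.Nat using (ℕ; suc)
open import Data.Bool using (Bool; true; false; _∧_; _∨_; not)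
open import Data.Fin using (Fin; _≟_)
open import Data.List using (length; filterᵇ)
open import Data.List.Base using () renaming (allFin to allFinL)
open import Relation.Nullary.Decidable using (⌊_⌋)
open import Relation.Binary.PropositionalEquality using (_≡_)
open import Data.Product using (∃₂)

record Graph (n : ℕ) : Set where
  field
    adj   : Fin n → Fin n → Bool
    sym   : ∀ u v → adj u v ≡ adj v u
    irrfl : ∀ v → adj v v ≡ false
open Graph public

count : ∀ {n} → (Fin n → Bool) → ℕ
count {n} p = length (filterᵇ p (allFinL n))

degree : ∀ {n} → Graph n → Fin n → ℕ
degree G v = count (adj G v)

Regular : ∀ {n} → ℕ → Graph n → Set
Regular r G = ∀ v → degree G v ≡ r

-- side v ≡ false means v ∈ X, side v ≡ true means v ∈ Y;
-- (X , Y) is a bipartition: every edge joins X and Y.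
IsBipartition : ∀ {n} → Graph n → (Fin n → Bool) → Set
IsBipartition G side = ∀ u v → adj G u v ≡ true → side u ≡ not (side v)

inN : ∀ {n} → Graph n → Fin n → Fin n → Bool
inN G v u = ⌊ u ≟ v ⌋ ∨ adj G v u

TotallySilverColoring : ∀ {n} → Graph n → (k : ℕ) → (Fin n → Fin k) → Set
TotallySilverColoring G k c =
  ∀ v (a : Fin k) → count (λ u → inN G v u ∧ ⌊ c u ≟ a ⌋) ≡ 1

TotallySilver : ∀ {n} → Graph n → Set
TotallySilver G = ∃₂ λ k c → TotallySilverColoring G k c

InducedOneRegular : ∀ {n} → Graph n → (Fin n → Bool) → Set
InducedOneRegular G S = ∀ w → S w ≡ true → count (λ u → adj G w u ∧ S u) ≡ 1

-- Given the bipartition side and an index map part : Fin n → Fin (suc r),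
-- U i = {x ∈ X | part x = i}, V j = {y ∈ Y | part y = j}.
-- (These are automatically pairwise disjoint and cover X resp. Y.)
inUV : ∀ {n r} → (Fin n → Bool) → (Fin n → Fin (suc r)) →
       Fin (suc r) → Fin (suc r) → Fin n → Bool
inUV side part i j w with side w
... | false = ⌊ part w ≟ i ⌋
... | true  = ⌊ part w ≟ j ⌋

module Submission where

-- Since N[v] = {v} ∪ N(v), colour a occurs on N[v] as often as [c v = a]
-- plus its number of occurrences on N(v).  Hence a totally silver colouring
-- has exactly |N[v]| = r + 1 colours and every vertex sees each foreign
-- colour once among its neighbours; conversely, in an r-regular graph such a
-- colouring with r + 1 colours is totally silver, because the r foreign
-- colours exhaust the degree, so no neighbour repeats v's own colour.  In a
-- bipartite graph the neighbours of w inside U_i ∪ V_j are its neighbours of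
-- colour j (w ∈ X) resp. i (w ∈ Y), so the matching condition says exactly
-- that the colouring by class index sees each foreign colour once.

open import Defs hiding (sym)
open import Data.Nat using (ℕ; zero; suc; _+_; _≤_)
open import Data.Nat.Properties using (+-0-commutativeMonoid; +-cancelʳ-≡)
open import Data.Bool using (Bool; true; false; _∧_; _∨_; not; if_then_else_)
open import Data.Bool.Properties using (if-not)
open import Data.Fin using (Fin; _≟_; punchIn) renaming (zero to fzero; suc to fsuc)
open import Data.Fin.Properties using (punchInᵢ≢i)
open import Data.List using (length; filterᵇ; tabulate)
open import Data.Product using (∃; _,_)
open import Function using (id)
open import Function.Bundles using (_⇔_; mk⇔)
open import Relation.Nullary using (¬_; Dec; yes; no)
open import Relation.Nullary.Decidable using (⌊_⌋; isYes≗does; dec-true; dec-false)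
open import Relation.Binary.PropositionalEquality
  using (_≡_; _≢_; _≗_; refl; sym; trans; cong; cong₂; module ≡-Reasoning)
open import Algebra.Properties.CommutativeMonoid.Sum +-0-commutativeMonoid
  using (sum-syntax; sum-remove; sum-cong-≗; sum-replicate-zero; ∑-comm)

open ≡-Reasoning

⌊⌋-true : ∀ {A : Set} (a? : Dec A) → A → ⌊ a? ⌋ ≡ true
⌊⌋-true a? a = trans (isYes≗does a?) (dec-true a? a)

⌊⌋-false : ∀ {A : Set} (a? : Dec A) → ¬ A → ⌊ a? ⌋ ≡ false
⌊⌋-false a? ¬a = trans (isYes≗does a?) (dec-false a? ¬a)

⌊⌋-sound : ∀ {A : Set} (a? : Dec A) → ⌊ a? ⌋ ≡ true → A
⌊⌋-sound (yes a) _ = a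

∧-congʳ-when : ∀ b {x y} → (b ≡ true → x ≡ y) → b ∧ x ≡ b ∧ y
∧-congʳ-when true  x≡y = x≡y refl
∧-congʳ-when false x≡y = refl

∑-ones : ∀ {n} (f : Fin n → ℕ) → (∀ i → f i ≡ 1) → ∑[ i < n ] f i ≡ n
∑-ones {zero}  f ones = refl
∑-ones {suc n} f ones = cong₂ _+_ (ones fzero) (∑-ones (λ i → f (fsuc i)) (λ i → ones (fsuc i)))

∑-zeros : ∀ {n} (f : Fin n → ℕ) → (∀ i → f i ≡ 0) → ∑[ i < n ] f i ≡ 0
∑-zeros {n} f zeros = trans (sum-cong-≗ zeros) (sum-replicate-zero n)

∑-pull : ∀ {n} (f : Fin (suc n) → ℕ) (i : Fin (suc n)) →
         ∑[ j < suc n ] f j ≡ f i + ∑[ j < n ] f (punchIn i j)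
∑-pull f i = sum-remove {i = i} f

∑-ones-except : ∀ {r} (f : Fin (suc r) → ℕ) (i : Fin (suc r)) →
                (∀ j → j ≢ i → f j ≡ 1) → ∑[ j < suc r ] f j ≡ f i + r
∑-ones-except f i ones =
  trans (∑-pull f i) (cong (f i +_) (∑-ones _ (λ j → ones (punchIn i j) (punchInᵢ≢i i j))))

⟦_⟧ : Bool → ℕ
⟦ true ⟧  = 1
⟦ false ⟧ = 0

∑-delta : ∀ {k} (x : Fin k) → ∑[ a < k ] ⟦ ⌊ x ≟ a ⌋ ⟧ ≡ 1
∑-delta {suc k} x = begin
  ∑[ a < suc k ] ⟦ ⌊ x ≟ a ⌋ ⟧                      ≡⟨ ∑-pull (λ a → ⟦ ⌊ x ≟ a ⌋ ⟧) x ⟩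
  ⟦ ⌊ x ≟ x ⌋ ⟧ + ∑[ j < k ] ⟦ ⌊ x ≟ punchIn x j ⌋ ⟧ ≡⟨ cong₂ _+_ (cong ⟦_⟧ (⌊⌋-true (x ≟ x) refl)) offDiagonal ⟩
  1                                                  ∎
  where
  offDiagonal : ∑[ j < k ] ⟦ ⌊ x ≟ punchIn x j ⌋ ⟧ ≡ 0
  offDiagonal = ∑-zeros _ (λ j → cong ⟦_⟧ (⌊⌋-false (x ≟ punchIn x j) (λ e → punchInᵢ≢i x j (sym e))))

count-tabulate : ∀ {A : Set} {n} (f : Fin n → A) (p : A → Bool) →
                 length (filterᵇ p (tabulate f)) ≡ ∑[ u < n ] ⟦ p (f u) ⟧
count-tabulate {n = zero}  f p = refl
count-tabulate {n = suc n} f p with p (f fzero)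
... | true  = cong suc (count-tabulate (λ u → f (fsuc u)) p)
... | false = count-tabulate (λ u → f (fsuc u)) p

count≡∑ : ∀ {n} (p : Fin n → Bool) → count p ≡ ∑[ u < n ] ⟦ p u ⟧
count≡∑ p = count-tabulate id p

count-cong : ∀ {n} {p q : Fin n → Bool} → p ≗ q → count p ≡ count q
count-cong {p = p} {q} p≗q = begin
  count p             ≡⟨ count≡∑ p ⟩
  ∑[ u < _ ] ⟦ p u ⟧  ≡⟨ sum-cong-≗ (λ u → cong ⟦_⟧ (p≗q u)) ⟩
  ∑[ u < _ ] ⟦ q u ⟧  ≡⟨ count≡∑ q ⟨
  count q             ∎

count-remove : ∀ {n} (p q : Fin n → Bool) (v : Fin n) →
               (∀ u → u ≢ v → p u ≡ q u) → q v ≡ false → count p ≡ ⟦ p v ⟧ + count q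
count-remove {suc n} p q v agree qv = begin
  count p                                              ≡⟨ count≡∑ p ⟩
  ∑[ u < suc n ] ⟦ p u ⟧                               ≡⟨ ∑-pull (λ u → ⟦ p u ⟧) v ⟩
  ⟦ p v ⟧ + ∑[ j < n ] ⟦ p (punchIn v j) ⟧             ≡⟨ cong (⟦ p v ⟧ +_) (sum-cong-≗ agreeOff) ⟩
  ⟦ p v ⟧ + (⟦ false ⟧ + ∑[ j < n ] ⟦ q (punchIn v j) ⟧) ≡⟨ cong (λ b → ⟦ p v ⟧ + (⟦ b ⟧ + ∑[ j < n ] ⟦ q (punchIn v j) ⟧)) qv ⟨
  ⟦ p v ⟧ + (⟦ q v ⟧ + ∑[ j < n ] ⟦ q (punchIn v j) ⟧) ≡⟨ cong (⟦ p v ⟧ +_) (∑-pull (λ u → ⟦ q u ⟧) v) ⟨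
  ⟦ p v ⟧ + ∑[ u < suc n ] ⟦ q u ⟧                     ≡⟨ cong (⟦ p v ⟧ +_) (count≡∑ q) ⟨
  ⟦ p v ⟧ + count q                                    ∎
  where
  agreeOff : ∀ j → ⟦ p (punchIn v j) ⟧ ≡ ⟦ q (punchIn v j) ⟧
  agreeOff j = cong ⟦_⟧ (agree (punchIn v j) (punchInᵢ≢i v j))

⟦⟧-fibres : ∀ {k} (b : Bool) (x : Fin k) → ⟦ b ⟧ ≡ ∑[ a < k ] ⟦ b ∧ ⌊ x ≟ a ⌋ ⟧
⟦⟧-fibres     true  x = sym (∑-delta x)
⟦⟧-fibres {k} false x = sym (∑-zeros {k} (λ _ → 0) (λ _ → refl))

count-fibres : ∀ {n k} (p : Fin n → Bool) (f : Fin n → Fin k) →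
               count p ≡ ∑[ a < k ] count (λ u → p u ∧ ⌊ f u ≟ a ⌋)
count-fibres {n} {k} p f = begin
  count p                                            ≡⟨ count≡∑ p ⟩
  ∑[ u < n ] ⟦ p u ⟧                                 ≡⟨ sum-cong-≗ (λ u → ⟦⟧-fibres (p u) (f u)) ⟩
  ∑[ u < n ] ∑[ a < k ] ⟦ p u ∧ ⌊ f u ≟ a ⌋ ⟧         ≡⟨ ∑-comm (λ u a → ⟦ p u ∧ ⌊ f u ≟ a ⌋ ⟧) ⟩
  ∑[ a < k ] ∑[ u < n ] ⟦ p u ∧ ⌊ f u ≟ a ⌋ ⟧         ≡⟨ sum-cong-≗ (λ a → count≡∑ (λ u → p u ∧ ⌊ f u ≟ a ⌋)) ⟨
  ∑[ a < k ] count (λ u → p u ∧ ⌊ f u ≟ a ⌋)         ∎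

closed-count : ∀ {n} (G : Graph n) (q : Fin n → Bool) (v : Fin n) →
               count (λ u → inN G v u ∧ q u) ≡ ⟦ q v ⟧ + count (λ u → adj G v u ∧ q u)
closed-count G q v = begin
  count (λ u → inN G v u ∧ q u)   ≡⟨ count-remove _ _ v awayFromV (cong (_∧ q v) (irrfl G v)) ⟩
  ⟦ inN G v v ∧ q v ⟧ + openCount  ≡⟨ cong (λ b → ⟦ (b ∨ adj G v v) ∧ q v ⟧ + openCount) (⌊⌋-true (v ≟ v) refl) ⟩
  ⟦ q v ⟧ + openCount              ∎
  where
  openCount : ℕ
  openCount = count (λ u → adj G v u ∧ q u)

  awayFromV : ∀ u → u ≢ v → inN G v u ∧ q u ≡ adj G v u ∧ q u
  awayFromV u u≢v = cong (λ b → (b ∨ adj G v u) ∧ q u) (⌊⌋-false (u ≟ v) u≢v)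

closed-size : ∀ {n} (G : Graph n) (v : Fin n) → count (inN G v) ≡ suc (degree G v)
closed-size G v = trans (count-remove (inN G v) (adj G v) v awayFromV (irrfl G v))
                        (cong (λ b → ⟦ b ∨ adj G v v ⟧ + degree G v) (⌊⌋-true (v ≟ v) refl))
  where
  awayFromV : ∀ u → u ≢ v → inN G v u ≡ adj G v u
  awayFromV u u≢v = cong (_∨ adj G v u) (⌊⌋-false (u ≟ v) u≢v)

neighboursOfColour : ∀ {n k} → Graph n → (Fin n → Fin k) → Fin n → Fin k → ℕ
neighboursOfColour G c v a = count (λ u → adj G v u ∧ ⌊ c u ≟ a ⌋)

-- A totally silver colouring uses exactly |N[v]| colours, for every vertex v:
-- each colour occurs once on N[v], and N[v] is the union of its colour classes.
silver-colour-number : ∀ {n k} (G : Graph n) (c : Fin n → Fin k) →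
                       TotallySilverColoring G k c → ∀ v → k ≡ suc (degree G v)
silver-colour-number {k = k} G c silver v = begin
  k                                              ≡⟨ ∑-ones _ (silver v) ⟨
  ∑[ a < k ] count (λ u → inN G v u ∧ ⌊ c u ≟ a ⌋) ≡⟨ count-fibres (inN G v) c ⟨
  count (inN G v)                                ≡⟨ closed-size G v ⟩
  suc (degree G v)                               ∎

ForeignColoursOnce : ∀ {n k} → Graph n → (Fin n → Fin k) → Set
ForeignColoursOnce G c = ∀ v a → c v ≢ a → neighboursOfColour G c v a ≡ 1

-- A colour a ≠ c v occurs on N[v] exactly where it occurs on N(v).
silver⇒foreign : ∀ {n k} (G : Graph n) (c : Fin n → Fin k) →
                 TotallySilverColoring G k c → ForeignColoursOnce G c
silver⇒foreign G c silver v a cv≢a = begin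
  neighboursOfColour G c v a                    ≡⟨ cong (λ b → ⟦ b ⟧ + neighboursOfColour G c v a) (⌊⌋-false (c v ≟ a) cv≢a) ⟨
  ⟦ ⌊ c v ≟ a ⌋ ⟧ + neighboursOfColour G c v a  ≡⟨ closed-count G (λ u → ⌊ c u ≟ a ⌋) v ⟨
  count (λ u → inN G v u ∧ ⌊ c u ≟ a ⌋)         ≡⟨ silver v a ⟩
  1                                             ∎

own-colour-absent : ∀ {n r} (G : Graph n) → Regular r G → (c : Fin n → Fin (suc r)) →
                    ForeignColoursOnce G c → ∀ v → neighboursOfColour G c v (c v) ≡ 0
own-colour-absent {r = r} G regular c foreign v = +-cancelʳ-≡ r (nbrs (c v)) 0 (begin
  nbrs (c v) + r            ≡⟨ ∑-ones-except nbrs (c v) (λ a a≢cv → foreign v a (λ e → a≢cv (sym e))) ⟨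
  ∑[ a < suc r ] nbrs a     ≡⟨ count-fibres (adj G v) c ⟨
  degree G v                ≡⟨ regular v ⟩
  r                         ∎)
  where
  nbrs : Fin (suc r) → ℕ
  nbrs = neighboursOfColour G c v

-- Conversely, in an r-regular graph such a colouring with r + 1 colours is
-- totally silver: N[v] contains v's colour once (v itself) and every other
-- colour once (a neighbour).
foreign⇒silver : ∀ {n r} (G : Graph n) → Regular r G → (c : Fin n → Fin (suc r)) →
                 ForeignColoursOnce G c → TotallySilverColoring G (suc r) c
foreign⇒silver G regular c foreign v a with c v ≟ a
... | yes refl = trans (closed-count G (λ u → ⌊ c u ≟ c v ⌋) v)
                       (cong₂ _+_ (cong ⟦_⟧ (⌊⌋-true (c v ≟ c v) refl)) (own-colour-absent G regular c foreign v))
... | no cv≢a  = trans (closed-count G (λ u → ⌊ c u ≟ a ⌋) v)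
                       (cong₂ _+_ (cong ⟦_⟧ (⌊⌋-false (c v ≟ a) cv≢a)) (foreign v a cv≢a))

-- A totally silver r-regular graph has a totally silver colouring with exactly
-- r + 1 colours (when there are no vertices, the empty colouring will do).
silver-with-r+1-colours : ∀ {n r} (G : Graph n) → Regular r G → TotallySilver G →
                          ∃ λ (c : Fin n → Fin (suc r)) → TotallySilverColoring G (suc r) c
silver-with-r+1-colours {zero}  G _ _ = (λ ()) , (λ ())
silver-with-r+1-colours {suc n} G regular (k , c , silver)
  with trans (silver-colour-number G c silver fzero) (cong suc (regular fzero))
... | refl = c , silver

inUV-index : ∀ {n r} (side : Fin n → Bool) (part : Fin n → Fin (suc r)) (i j : Fin (suc r)) {w : Fin n} {s : Bool} →
             side w ≡ s → inUV side part i j w ≡ ⌊ part w ≟ (if s then j else i) ⌋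
inUV-index side part i j {w} refl with side w
... | false = refl
... | true  = refl

-- Neighbours of w lie on the other side, so a neighbour is in U_i ∪ V_j iff its
-- class index is the one prescribed for the opposite side of w.
inUV-neighbour : ∀ {n r} (G : Graph n) (side : Fin n → Bool) → IsBipartition G side →
                 (part : Fin n → Fin (suc r)) (i j : Fin (suc r)) {w u : Fin n} {s : Bool} →
                 side w ≡ s → adj G w u ≡ true →
                 inUV side part i j u ≡ ⌊ part u ≟ (if s then i else j) ⌋
inUV-neighbour G side bipartite part i j {w} {u} {s} sw wu = begin
  inUV side part i j u                       ≡⟨ inUV-index side part i j sideU ⟩
  ⌊ part u ≟ (if not s then j else i) ⌋      ≡⟨ cong (λ t → ⌊ part u ≟ t ⌋) (if-not s) ⟩
  ⌊ part u ≟ (if s then i else j) ⌋          ∎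
  where
  sideU : side u ≡ not s
  sideU = trans (bipartite u w (trans (Graph.sym G u w) wu)) (cong not sw)

neighbours-in-UV : ∀ {n r} (G : Graph n) (side : Fin n → Bool) → IsBipartition G side →
                   (part : Fin n → Fin (suc r)) (i j : Fin (suc r)) {w : Fin n} {s : Bool} →
                   side w ≡ s → count (λ u → adj G w u ∧ inUV side part i j u) ≡
                                neighboursOfColour G part w (if s then i else j)
neighbours-in-UV G side bipartite part i j sw =
  count-cong (λ u → ∧-congʳ-when (adj G _ u) (inUV-neighbour G side bipartite part i j sw))

ClassMatchings : ∀ {n r} → Graph n → (Fin n → Bool) → (Fin n → Fin (suc r)) → Set
ClassMatchings G side part = ∀ i j → i ≢ j → InducedOneRegular G (inUV side part i j)

-- If w ∈ U_i ∪ V_j then w has its own side's index and its neighbours in U_i ∪ V_j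
-- are those of the other index, which is a foreign colour since i ≠ j.
foreign⇒matchings : ∀ {n r} (G : Graph n) (side : Fin n → Bool) → IsBipartition G side →
                    (part : Fin n → Fin (suc r)) → ForeignColoursOnce G part → ClassMatchings G side part
foreign⇒matchings G side bipartite part foreign i j i≢j w w∈UV = begin
  count (λ u → adj G w u ∧ inUV side part i j u)    ≡⟨ neighbours-in-UV G side bipartite part i j refl ⟩
  neighboursOfColour G part w (if side w then i else j) ≡⟨ foreign w _ (λ e → indices-apart (side w) (trans (sym own) e)) ⟩
  1                                                 ∎
  where
  own : part w ≡ (if side w then j else i)
  own = ⌊⌋-sound (part w ≟ _) (trans (sym (inUV-index side part i j refl)) w∈UV)
  indices-apart : ∀ b → (if b then j else i) ≢ (if b then i else j)
  indices-apart false = i≢j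
  indices-apart true  = λ e → i≢j (sym e)

-- Conversely, for v ∈ X (resp. Y) and a foreign colour a, the class
-- U_{part v} ∪ V_a (resp. U_a ∪ V_{part v}) contains v, and the neighbours of v
-- in it are exactly its neighbours of colour a.
matchings⇒foreign : ∀ {n r} (G : Graph n) (side : Fin n → Bool) → IsBipartition G side →
                    (part : Fin n → Fin (suc r)) → ClassMatchings G side part → ForeignColoursOnce G part
matchings⇒foreign G side bipartite part matchings v a pv≢a with side v in sv
... | false = trans (sym (neighbours-in-UV G side bipartite part (part v) a sv))
                    (matchings (part v) a pv≢a v
                      (trans (inUV-index side part (part v) a sv) (⌊⌋-true (part v ≟ part v) refl)))
... | true  = trans (sym (neighbours-in-UV G side bipartite part a (part v) sv))
                    (matchings a (part v) (λ e → pv≢a (sym e)) v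
                      (trans (inUV-index side part a (part v) sv) (⌊⌋-true (part v ≟ part v) refl)))

-- The argument does not need the hypothesis r ≥ 1.
corollary2p9 : (r : ℕ) → 1 ≤ r → (n : ℕ) → (G : Graph n) → Regular r G →
    (side : Fin n → Bool) → IsBipartition G side →
    TotallySilver G ⇔
      ∃ λ (part : Fin n → Fin (suc r)) →
        ∀ (i j : Fin (suc r)) → ¬ i ≡ j → InducedOneRegular G (inUV side part i j)
corollary2p9 r _ n G regular side bipartite = mk⇔ toMatchings toSilver
  where
  toMatchings : TotallySilver G → ∃ λ part → ClassMatchings G side part
  toMatchings silver with silver-with-r+1-colours G regular silver
  ... | c , silverC = c , foreign⇒matchings G side bipartite c (silver⇒foreign G c silverC)

  toSilver : (∃ λ part → ClassMatchings G side part) → TotallySilver G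
  toSilver (part , matchings) =
    suc r , part , foreign⇒silver G regular part (matchings⇒foreign G side bipartite part matchings)
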